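{- Let $r\ge 5$ be an integer and let $C$ be a finite simple graph on $r+1$ vertices having no vertex cover of size $1$, such that the number $c_3$ of vertex covers of size $3$ in $C$ satisfies \[ 4r-16+\frac{36}{r+2}\le c_3<4r-8. \] Then $C$ is either the disjoint union of a $K_3$ with isolated vertices, or the disjoint union of a path $P_4$ (on 4 vertices) with isolated vertices.
   Context: A vertex cover of a graph is a set $S$ of vertices such that every edge has at least one endpoint in $S$; vertex covers of size $k$ are counted as distinct $k$-element vertex subsets. -}

module Defs where

open import Data.Nat using (ℕ; zero; suc)
open import Data.Nat.Properties using (_≟_)
open import Data.Bool using (Bool; true; false)
open import Data.Fin using (Fin)
open import Data.Fin.Properties using (all?)
open import Data.Fin.Subset using (Subset; _∈_; ∣_∣; inside; outside)
open import Data.Fin.Subset.Properties using (_∈?_)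
open import Data.Vec using (_∷_; [])
open import Data.List using (List; _∷_; []; _++_; map; filter; length)
open import Data.Sum using (_⊎_)
open import Data.Product using (_×_)
open import Relation.Binary.PropositionalEquality using (_≡_; _≢_)
open import Relation.Nullary using (Dec; yes; no; ¬_)
open import Relation.Nullary.Decidable using (_×-dec_; _⊎-dec_; _→-dec_)

record Graph (n : ℕ) : Set where
  field
    adj   : Fin n → Fin n → Bool
    sym   : ∀ i j → adj i j ≡ adj j i
    irrefl : ∀ i → adj i i ≡ false

open Graph public

Edge : ∀ {n} → Graph n → Fin n → Fin n → Set
Edge G i j = adj G i j ≡ true

IsVertexCover : ∀ {n} → Graph n → Subset n → Set
IsVertexCover G S = ∀ i j → Edge G i j → (i ∈ S) ⊎ (j ∈ S)

isVertexCover? : ∀ {n} (G : Graph n) (S : Subset n) → Dec (IsVertexCover G S)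
isVertexCover? G S =
  all? λ i → all? λ j → (adj G i j Data.Bool.≟ true) →-dec ((i ∈? S) ⊎-dec (j ∈? S))
  where import Data.Bool

allSubsets : (n : ℕ) → List (Subset n)
allSubsets zero = [] ∷ []
allSubsets (suc n) = map (inside ∷_) (allSubsets n) ++ map (outside ∷_) (allSubsets n)

numVertexCovers : ∀ {n} → Graph n → ℕ → ℕ
numVertexCovers {n} G k =
  length (filter (λ S → (∣ S ∣ ≟ k) ×-dec isVertexCover? G S) (allSubsets n))

IsK3PlusIsolated : ∀ {n} → Graph n → Set
IsK3PlusIsolated {n} G =
  Data.Product.Σ (Fin n) λ a → Data.Product.Σ (Fin n) λ b → Data.Product.Σ (Fin n) λ c →
    (a ≢ b) × (a ≢ c) × (b ≢ c) ×
    (∀ i j → Edge G i j →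
        ((i ≡ a × j ≡ b) ⊎ (i ≡ b × j ≡ a)) ⊎
        ((i ≡ b × j ≡ c) ⊎ (i ≡ c × j ≡ b)) ⊎
        ((i ≡ a × j ≡ c) ⊎ (i ≡ c × j ≡ a))) ×
    Edge G a b × Edge G b c × Edge G a c
  where import Data.Product

IsP4PlusIsolated : ∀ {n} → Graph n → Set
IsP4PlusIsolated {n} G =
  Data.Product.Σ (Fin n) λ a → Data.Product.Σ (Fin n) λ b →
  Data.Product.Σ (Fin n) λ c → Data.Product.Σ (Fin n) λ d →
    (a ≢ b) × (a ≢ c) × (a ≢ d) × (b ≢ c) × (b ≢ d) × (c ≢ d) ×
    (∀ i j → Edge G i j →
        ((i ≡ a × j ≡ b) ⊎ (i ≡ b × j ≡ a)) ⊎
        ((i ≡ b × j ≡ c) ⊎ (i ≡ c × j ≡ b)) ⊎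
        ((i ≡ c × j ≡ d) ⊎ (i ≡ d × j ≡ c))) ×
    Edge G a b × Edge G b c × Edge G c d
  where import Data.Product

-- Write n = r + 1 and c for the number of 3-element vertex covers. If no vertex cover has at
-- most two vertices, branching on the endpoints of uncovered edges gives c ≤ 2³. Otherwise some
-- pair {u, v} covers every edge; u ≠ v, and each of u, v has a neighbour besides the other,
-- since no single vertex is a cover. Sort the 3-covers S by whether u ∈ S and v ∈ S: a vertex
-- outside S has all its neighbours in S, so each class is compared with a family
-- {S | T ⊆ S ⊆ U, ∣S∣ = 3}, whose size is a binomial coefficient. If u or v has two neighbours
-- besides the other, this gives c ≤ 2n − 3 = 2r − 1 unless the graph is a P₄. If each has
-- exactly one, the graph is a K₃ or a P₄ when uv is an edge, and otherwise it is two disjoint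
-- edges with c = 4n − 12 = 4r − 8. The hypotheses on c exclude c ≤ 2r − 1 (as r ≥ 5) and
-- c ≥ 4r − 8.

module Submission where

open import Defs renaming (sym to adj-sym)
open import Data.Nat using (ℕ; zero; suc; _+_; _*_; _∸_; _≤_; _<_; _^_; z≤n; s≤s; z<s)
open import Data.Nat.Properties
open import Data.Nat.Combinatorics using (nC1≡n; nCk+nC[k+1]≡[n+1]C[k+1]) renaming (_C_ to _choose_)
open import Data.Nat.Tactic.RingSolver using (solve-∀)
open import Data.Bool using (true; false)
import Data.Bool as Bool
open import Data.Fin using (Fin; zero; suc)
open import Data.Fin.Properties using (all?; any?; ¬∀⟶∃¬)
import Data.Fin.Properties as Fin
open import Data.Fin.Subset using (Subset; ∣_∣; inside; outside; _∈_; _∉_; _⊆_; ⁅_⁆; _∪_; ∁; ⊥; ⊤)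
open import Data.Fin.Subset.Properties
  using ( _∈?_; _⊆?_; anySubset?; drop-∷-⊆; out⊆; in⊆in; ⊆⊤; ⊥⊆; ∉⊥; p⊆p∪q; q⊆p∪q; x∈p∪q⁻
        ; ∪-identityˡ; ∪-idem; x∈⁅x⁆; x∈⁅y⁆⇒x≡y; x≢y⇒x∉⁅y⁆; x∉⁅y⁆⇒x≢y; x∉p⇒x∈∁p; x∈∁p⇒x∉p
        ; p⊆q⇒∣p∣≤∣q∣; ∣⊥∣≡0; ∣⁅x⁆∣≡1; ∣∁p∣≡n∸∣p∣ )
open import Data.Vec using (_∷_; []; here; there)
open import Data.List using (List; _∷_; []; _++_; map; filter; length)
open import Data.List.Properties using (length-++; length-map; filter-++; filter-≐; filter-none)
open import Data.List.Membership.Propositional using () renaming (_∈_ to _∈ₗ_)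
open import Data.List.Membership.Propositional.Properties using (∈-map⁺)
open import Data.List.Relation.Unary.Any using (here; there)
open import Data.List.Relation.Unary.All using (universal)
open import Data.List.Relation.Binary.Sublist.Propositional using (⊆-refl)
open import Data.List.Relation.Binary.Sublist.Propositional.Properties using (filter⁺; length-mono-≤)
open import Data.Sum using (_⊎_; inj₁; inj₂; [_,_]′)
import Data.Sum as Sum
open import Data.Product using (_×_; _,_; ∃; ∃₂; proj₁; proj₂; swap)
open import Data.Empty using (⊥-elim)
open import Function using (_∘_; id; const; case_of_)
open import Level using (0ℓ)
open import Relation.Binary.PropositionalEquality
open import Relation.Nullary using (¬_; Dec; yes; no; does)
open import Relation.Nullary.Decidable using (¬?; _×-dec_; _⊎-dec_; _→-dec_; decidable-stable)
open import Relation.Unary using (Pred; Decidable; _≐_; _∩_) renaming (_⊆_ to _⇒_)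
open import Relation.Unary.Properties using (∁?; _∩?_)

private variable
  n : ℕ
  A B : Set

-- Counting subsets

length-filter-map : {P : Pred B 0ℓ} (P? : Decidable P) (f : A → B) (xs : List A) →
  length (filter P? (map f xs)) ≡ length (filter (P? ∘ f) xs)
length-filter-map P? f [] = refl
length-filter-map P? f (x ∷ xs) with does (P? (f x))
... | true  = cong suc (length-filter-map P? f xs)
... | false = length-filter-map P? f xs

length-filter-split : {P Q : Pred A 0ℓ} (P? : Decidable P) (Q? : Decidable Q) (xs : List A) →
  length (filter P? xs) ≡ length (filter (P? ∩? Q?) xs) + length (filter (P? ∩? ∁? Q?) xs)
length-filter-split P? Q? [] = refl
length-filter-split P? Q? (x ∷ xs) with does (P? x) | does (Q? x)
... | true  | true  = cong suc (length-filter-split P? Q? xs)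
... | true  | false = trans (cong suc (length-filter-split P? Q? xs)) (sym (+-suc _ _))
... | false | _     = length-filter-split P? Q? xs

-- Opaque so that unification can recover a predicate from its count.
opaque
  countSubsets : {P : Pred (Subset n) 0ℓ} → Decidable P → ℕ
  countSubsets P? = length (filter P? (allSubsets _))

opaque
  unfolding countSubsets

  countSubsets-mono : {P Q : Pred (Subset n) 0ℓ} (P? : Decidable P) (Q? : Decidable Q) →
    P ⇒ Q → countSubsets P? ≤ countSubsets Q?
  countSubsets-mono {n} P? Q? P⇒Q =
    length-mono-≤ (filter⁺ P? Q? (λ { refl → P⇒Q }) (⊆-refl {x = allSubsets n}))

  countSubsets-cong : {P Q : Pred (Subset n) 0ℓ} (P? : Decidable P) (Q? : Decidable Q) →
    P ≐ Q → countSubsets P? ≡ countSubsets Q?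
  countSubsets-cong P? Q? P≐Q = cong length (filter-≐ P? Q? P≐Q (allSubsets _))

  countSubsets-split : {P Q : Pred (Subset n) 0ℓ} (P? : Decidable P) (Q? : Decidable Q) →
    countSubsets P? ≡ countSubsets (P? ∩? Q?) + countSubsets (P? ∩? ∁? Q?)
  countSubsets-split P? Q? = length-filter-split P? Q? (allSubsets _)

  countSubsets-empty : {P : Pred (Subset n) 0ℓ} (P? : Decidable P) → (∀ S → ¬ P S) → countSubsets P? ≡ 0
  countSubsets-empty {n} P? ∄ = cong length (filter-none P? (universal ∄ (allSubsets n)))

  countSubsets-∷ : {P : Pred (Subset (suc n)) 0ℓ} (P? : Decidable P) →
    countSubsets P? ≡ countSubsets (P? ∘ (inside ∷_)) + countSubsets (P? ∘ (outside ∷_))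
  countSubsets-∷ {n} P? = begin
    length (filter P? (map (inside ∷_) Ss ++ map (outside ∷_) Ss))
      ≡⟨ cong length (filter-++ P? (map (inside ∷_) Ss) _) ⟩
    length (filter P? (map (inside ∷_) Ss) ++ filter P? (map (outside ∷_) Ss))
      ≡⟨ length-++ (filter P? (map (inside ∷_) Ss)) ⟩
    length (filter P? (map (inside ∷_) Ss)) + length (filter P? (map (outside ∷_) Ss))
      ≡⟨ cong₂ _+_ (length-filter-map P? (inside ∷_) Ss) (length-filter-map P? (outside ∷_) Ss) ⟩
    countSubsets (P? ∘ (inside ∷_)) + countSubsets (P? ∘ (outside ∷_)) ∎
    where
    open ≡-Reasoning
    Ss : List (Subset n)
    Ss = allSubsets n

  countSubsets₀ : {P : Pred (Subset 0) 0ℓ} (P? : Decidable P) →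
    countSubsets P? ≡ length (filter P? ([] ∷ []))
  countSubsets₀ P? = refl

Interval : Subset n → Subset n → ℕ → Pred (Subset n) 0ℓ
Interval T U m S = T ⊆ S × S ⊆ U × ∣ S ∣ ≡ m

interval? : (T U : Subset n) (m : ℕ) → Decidable (Interval T U m)
interval? T U m S = (T ⊆? S) ×-dec (S ⊆? U) ×-dec (∣ S ∣ ≟ m)

∷⊆inside∷ : ∀ {s} {p q : Subset n} → p ⊆ q → s ∷ p ⊆ inside ∷ q
∷⊆inside∷ {s = inside}  = in⊆in
∷⊆inside∷ {s = outside} = out⊆

Interval-inside : ∀ {t} {T U : Subset n} {m m′} → m′ ≡ suc m →
  (λ S → Interval (t ∷ T) (inside ∷ U) m′ (inside ∷ S)) ≐ Interval T U m
Interval-inside m′≡1+m =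
    (λ (T⊆S , S⊆U , ∣S∣≡m′) → drop-∷-⊆ T⊆S , drop-∷-⊆ S⊆U , suc-injective (trans ∣S∣≡m′ m′≡1+m))
  , (λ (T⊆S , S⊆U , ∣S∣≡m) → ∷⊆inside∷ T⊆S , in⊆in S⊆U , trans (cong suc ∣S∣≡m) (sym m′≡1+m))

Interval-outside : ∀ {u} {T U : Subset n} {m} →
  (λ S → Interval (outside ∷ T) (u ∷ U) m (outside ∷ S)) ≐ Interval T U m
Interval-outside = (λ (T⊆S , S⊆U , ∣S∣≡m) → drop-∷-⊆ T⊆S , drop-∷-⊆ S⊆U , ∣S∣≡m)
                 , (λ (T⊆S , S⊆U , ∣S∣≡m) → out⊆ T⊆S , out⊆ S⊆U , ∣S∣≡m)

countSubsets-interval : (T U : Subset n) (k : ℕ) → T ⊆ U →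
  countSubsets (interval? T U (∣ T ∣ + k)) ≡ (∣ U ∣ ∸ ∣ T ∣) choose k
countSubsets-interval [] [] zero    _ = countSubsets₀ (interval? [] [] 0)
countSubsets-interval [] [] (suc k) _ = countSubsets₀ (interval? [] [] (suc k))
countSubsets-interval (inside ∷ T) (outside ∷ U) k T⊆U with () ← T⊆U here
countSubsets-interval (inside ∷ T) (inside ∷ U) k T⊆U = begin
  countSubsets P?
    ≡⟨ countSubsets-∷ P? ⟩
  countSubsets (P? ∘ (inside ∷_)) + countSubsets (P? ∘ (outside ∷_))
    ≡⟨ cong₂ _+_ (countSubsets-cong (P? ∘ (inside ∷_)) _ (Interval-inside refl))
                 (countSubsets-empty (P? ∘ (outside ∷_)) λ { _ (T⊆S , _) → case T⊆S here of λ () }) ⟩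
  countSubsets (interval? T U (∣ T ∣ + k)) + 0
    ≡⟨ +-identityʳ _ ⟩
  countSubsets (interval? T U (∣ T ∣ + k))
    ≡⟨ countSubsets-interval T U k (drop-∷-⊆ T⊆U) ⟩
  (∣ U ∣ ∸ ∣ T ∣) choose k ∎
  where
  open ≡-Reasoning
  P? : Decidable (Interval (inside ∷ T) (inside ∷ U) (suc ∣ T ∣ + k))
  P? = interval? (inside ∷ T) (inside ∷ U) (suc ∣ T ∣ + k)
countSubsets-interval (outside ∷ T) (outside ∷ U) k T⊆U = begin
  countSubsets P?
    ≡⟨ countSubsets-∷ P? ⟩
  countSubsets (P? ∘ (inside ∷_)) + countSubsets (P? ∘ (outside ∷_))
    ≡⟨ cong₂ _+_ (countSubsets-empty (P? ∘ (inside ∷_)) λ { _ (_ , S⊆U , _) → case S⊆U here of λ () })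
                 (countSubsets-cong (P? ∘ (outside ∷_)) _ Interval-outside) ⟩
  countSubsets (interval? T U (∣ T ∣ + k))
    ≡⟨ countSubsets-interval T U k (drop-∷-⊆ T⊆U) ⟩
  (∣ U ∣ ∸ ∣ T ∣) choose k ∎
  where
  open ≡-Reasoning
  P? : Decidable (Interval (outside ∷ T) (outside ∷ U) (∣ T ∣ + k))
  P? = interval? (outside ∷ T) (outside ∷ U) (∣ T ∣ + k)
countSubsets-interval (outside ∷ T) (inside ∷ U) zero T⊆U = begin
  countSubsets P?
    ≡⟨ countSubsets-∷ P? ⟩
  countSubsets (P? ∘ (inside ∷_)) + countSubsets (P? ∘ (outside ∷_))
    ≡⟨ cong₂ _+_ (countSubsets-empty (P? ∘ (inside ∷_)) too-large)
                 (countSubsets-cong (P? ∘ (outside ∷_)) _ Interval-outside) ⟩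
  countSubsets (interval? T U (∣ T ∣ + 0))
    ≡⟨ countSubsets-interval T U 0 (drop-∷-⊆ T⊆U) ⟩
  (∣ U ∣ ∸ ∣ T ∣) choose 0 ∎
  where
  open ≡-Reasoning
  P? : Decidable (Interval (outside ∷ T) (inside ∷ U) (∣ T ∣ + 0))
  P? = interval? (outside ∷ T) (inside ∷ U) (∣ T ∣ + 0)
  too-large : ∀ S → ¬ Interval (outside ∷ T) (inside ∷ U) (∣ T ∣ + 0) (inside ∷ S)
  too-large S (T⊆S , _ , ∣S∣+1≡∣T∣) =
    ≤⇒≯ (p⊆q⇒∣p∣≤∣q∣ (drop-∷-⊆ T⊆S)) (≤-reflexive (trans ∣S∣+1≡∣T∣ (+-identityʳ ∣ T ∣)))
countSubsets-interval (outside ∷ T) (inside ∷ U) (suc k) T⊆U = begin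
  countSubsets P?
    ≡⟨ countSubsets-∷ P? ⟩
  countSubsets (P? ∘ (inside ∷_)) + countSubsets (P? ∘ (outside ∷_))
    ≡⟨ cong₂ _+_ (countSubsets-cong (P? ∘ (inside ∷_)) _ (Interval-inside (+-suc ∣ T ∣ k)))
                 (countSubsets-cong (P? ∘ (outside ∷_)) _ Interval-outside) ⟩
  countSubsets (interval? T U (∣ T ∣ + k)) + countSubsets (interval? T U (∣ T ∣ + suc k))
    ≡⟨ cong₂ _+_ (countSubsets-interval T U k T⊆U′) (countSubsets-interval T U (suc k) T⊆U′) ⟩
  (∣ U ∣ ∸ ∣ T ∣) choose k + (∣ U ∣ ∸ ∣ T ∣) choose suc k
    ≡⟨ nCk+nC[k+1]≡[n+1]C[k+1] (∣ U ∣ ∸ ∣ T ∣) k ⟩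
  suc (∣ U ∣ ∸ ∣ T ∣) choose suc k
    ≡⟨ cong (_choose suc k) (sym (+-∸-assoc 1 (p⊆q⇒∣p∣≤∣q∣ T⊆U′))) ⟩
  (suc ∣ U ∣ ∸ ∣ T ∣) choose suc k ∎
  where
  open ≡-Reasoning
  P? : Decidable (Interval (outside ∷ T) (inside ∷ U) (∣ T ∣ + suc k))
  P? = interval? (outside ∷ T) (inside ∷ U) (∣ T ∣ + suc k)
  T⊆U′ : T ⊆ U
  T⊆U′ = drop-∷-⊆ T⊆U

-- Subsets with at most three elements

∪-least : {p q r : Subset n} → p ⊆ r → q ⊆ r → p ∪ q ⊆ r
∪-least {p = p} {q} p⊆r q⊆r x∈p∪q = [ p⊆r , q⊆r ]′ (x∈p∪q⁻ p q x∈p∪q)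

⁅x⁆⊆ : {x : Fin n} {p : Subset n} → x ∈ p → ⁅ x ⁆ ⊆ p
⁅x⁆⊆ {x = x} {p} x∈p y∈⁅x⁆ = subst (_∈ p) (sym (x∈⁅y⁆⇒x≡y x y∈⁅x⁆)) x∈p

x∈⁅y⁆∪⁅z⁆⇒ : {x y z : Fin n} → x ∈ ⁅ y ⁆ ∪ ⁅ z ⁆ → x ≡ y ⊎ x ≡ z
x∈⁅y⁆∪⁅z⁆⇒ {y = y} {z} x∈ = Sum.map (x∈⁅y⁆⇒x≡y y) (x∈⁅y⁆⇒x≡y z) (x∈p∪q⁻ ⁅ y ⁆ ⁅ z ⁆ x∈)

∣⁅x⁆∪p∣≡1+∣p∣ : {x : Fin n} {p : Subset n} → x ∉ p → ∣ ⁅ x ⁆ ∪ p ∣ ≡ suc ∣ p ∣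
∣⁅x⁆∪p∣≡1+∣p∣ {x = zero}  {inside  ∷ p} x∉p = ⊥-elim (x∉p here)
∣⁅x⁆∪p∣≡1+∣p∣ {x = zero}  {outside ∷ p} x∉p = cong (suc ∘ ∣_∣) (∪-identityˡ p)
∣⁅x⁆∪p∣≡1+∣p∣ {x = suc x} {inside  ∷ p} x∉p = cong suc (∣⁅x⁆∪p∣≡1+∣p∣ (x∉p ∘ there))
∣⁅x⁆∪p∣≡1+∣p∣ {x = suc x} {outside ∷ p} x∉p = ∣⁅x⁆∪p∣≡1+∣p∣ (x∉p ∘ there)

∣⁅x⁆∪⁅y⁆∣≡2 : {x y : Fin n} → x ≢ y → ∣ ⁅ x ⁆ ∪ ⁅ y ⁆ ∣ ≡ 2
∣⁅x⁆∪⁅y⁆∣≡2 {y = y} x≢y = trans (∣⁅x⁆∪p∣≡1+∣p∣ (x≢y⇒x∉⁅y⁆ x≢y)) (cong suc (∣⁅x⁆∣≡1 y))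

∣⁅x⁆∪⁅y⁆∪⁅z⁆∣≡3 : {x y z : Fin n} → x ≢ y → x ≢ z → y ≢ z → ∣ ⁅ x ⁆ ∪ ⁅ y ⁆ ∪ ⁅ z ⁆ ∣ ≡ 3
∣⁅x⁆∪⁅y⁆∪⁅z⁆∣≡3 x≢y x≢z y≢z =
  trans (∣⁅x⁆∪p∣≡1+∣p∣ ([ x≢y , x≢z ]′ ∘ x∈⁅y⁆∪⁅z⁆⇒)) (cong suc (∣⁅x⁆∪⁅y⁆∣≡2 y≢z))

x∈⁅x⁆∪⁅y⁆ : {x y : Fin n} → x ∈ ⁅ x ⁆ ∪ ⁅ y ⁆
x∈⁅x⁆∪⁅y⁆ {x = x} = p⊆p∪q _ (x∈⁅x⁆ x)

y∈⁅x⁆∪⁅y⁆ : {x y : Fin n} → y ∈ ⁅ x ⁆ ∪ ⁅ y ⁆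
y∈⁅x⁆∪⁅y⁆ {y = y} = q⊆p∪q _ _ (x∈⁅x⁆ y)

⁅x⁆∪⁅y⁆⊆ : {x y : Fin n} {S : Subset n} → x ∈ S → y ∈ S → ⁅ x ⁆ ∪ ⁅ y ⁆ ⊆ S
⁅x⁆∪⁅y⁆⊆ x∈S y∈S = ∪-least (⁅x⁆⊆ x∈S) (⁅x⁆⊆ y∈S)

⁅x⁆∪⁅y⁆∪⁅z⁆⊆ : {x y z : Fin n} {S : Subset n} → x ∈ S → y ∈ S → z ∈ S → ⁅ x ⁆ ∪ ⁅ y ⁆ ∪ ⁅ z ⁆ ⊆ S
⁅x⁆∪⁅y⁆∪⁅z⁆⊆ x∈S y∈S z∈S = ∪-least (⁅x⁆⊆ x∈S) (⁅x⁆∪⁅y⁆⊆ y∈S z∈S)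

x∈⁅y⁆∪⁅z⁆∪⁅w⁆⇒ : {x y z w : Fin n} → x ∈ ⁅ y ⁆ ∪ ⁅ z ⁆ ∪ ⁅ w ⁆ → x ≡ y ⊎ x ≡ z ⊎ x ≡ w
x∈⁅y⁆∪⁅z⁆∪⁅w⁆⇒ {y = y} {z} {w} x∈ = Sum.map (x∈⁅y⁆⇒x≡y y) x∈⁅y⁆∪⁅z⁆⇒ (x∈p∪q⁻ ⁅ y ⁆ (⁅ z ⁆ ∪ ⁅ w ⁆) x∈)

⊆∁ : {F S : Subset n} → (∀ {x} → x ∈ F → x ∉ S) → S ⊆ ∁ F
⊆∁ disjoint x∈S = x∉p⇒x∈∁p (λ x∈F → disjoint x∈F x∈S)

⊆∁⇒∉ : {F S : Subset n} {x : Fin n} → S ⊆ ∁ F → x ∈ F → x ∉ S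
⊆∁⇒∉ S⊆∁F x∈F x∈S = x∈∁p⇒x∉p (S⊆∁F x∈S) x∈F

⊆∁⁅x⁆ : {x : Fin n} {S : Subset n} → x ∉ S → S ⊆ ∁ ⁅ x ⁆
⊆∁⁅x⁆ {x = x} {S} x∉S = ⊆∁ λ y∈⁅x⁆ → subst (_∉ S) (sym (x∈⁅y⁆⇒x≡y x y∈⁅x⁆)) x∉S

⊆∁⁅x⁆∪⁅y⁆ : {x y : Fin n} {S : Subset n} → x ∉ S → y ∉ S → S ⊆ ∁ (⁅ x ⁆ ∪ ⁅ y ⁆)
⊆∁⁅x⁆∪⁅y⁆ {S = S} x∉S y∉S = ⊆∁ λ z∈ → [ (λ { refl → x∉S }) , (λ { refl → y∉S }) ]′ (x∈⁅y⁆∪⁅z⁆⇒ z∈)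

elements : (T : Subset n) → ∃ λ (xs : List (Fin n)) → length xs ≡ ∣ T ∣ × (∀ {i} → i ∈ T → i ∈ₗ xs)
elements [] = [] , refl , λ ()
elements (inside ∷ T) with xs , ∣xs∣≡∣T∣ , T⊆xs ← elements T =
  zero ∷ map suc xs , cong suc (trans (length-map suc xs) ∣xs∣≡∣T∣) ,
  λ { here → here refl ; (there i∈T) → there (∈-map⁺ suc (T⊆xs i∈T)) }
elements (outside ∷ T) with xs , ∣xs∣≡∣T∣ , T⊆xs ← elements T =
  map suc xs , trans (length-map suc xs) ∣xs∣≡∣T∣ , λ { (there i∈T) → ∈-map⁺ suc (T⊆xs i∈T) }

⊆⁅x⁆∪⁅y⁆ : (T : Subset (suc n)) → ∣ T ∣ ≤ 2 → ∃₂ λ x y → T ⊆ ⁅ x ⁆ ∪ ⁅ y ⁆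
⊆⁅x⁆∪⁅y⁆ T ∣T∣≤2 with elements T
... | [] , _ , T⊆xs = zero , zero , λ i∈T → case T⊆xs i∈T of λ ()
... | x ∷ [] , _ , T⊆xs = x , x , λ i∈T → case T⊆xs i∈T of λ { (here refl) → x∈⁅x⁆∪⁅y⁆ }
... | x ∷ y ∷ [] , _ , T⊆xs = x , y , λ i∈T → case T⊆xs i∈T of λ
  { (here refl) → x∈⁅x⁆∪⁅y⁆ ; (there (here refl)) → y∈⁅x⁆∪⁅y⁆ }
... | _ ∷ _ ∷ _ ∷ _ , ∣xs∣≡∣T∣ , _ =
  ⊥-elim (≤⇒≯ ∣T∣≤2 (≤-trans (s≤s (s≤s (s≤s z≤n))) (≤-reflexive ∣xs∣≡∣T∣)))

countSubsets-interval-sized : {T U : Subset n} {t : ℕ} → ∣ T ∣ ≡ t → T ⊆ U → (k : ℕ) →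
  countSubsets (interval? T U (t + k)) ≡ (∣ U ∣ ∸ t) choose k
countSubsets-interval-sized refl T⊆U k = countSubsets-interval _ _ k T⊆U

countSubsets-⊇pair-avoiding : {a b : Fin n} {F : Subset n} {f : ℕ} → ∣ F ∣ ≡ f → a ≢ b → a ∉ F → b ∉ F →
  countSubsets (interval? (⁅ a ⁆ ∪ ⁅ b ⁆) (∁ F) 3) ≡ n ∸ (f + 2)
countSubsets-⊇pair-avoiding {n} {F = F} {f} ∣F∣≡f a≢b a∉F b∉F = begin
  countSubsets (interval? _ (∁ F) (2 + 1))
    ≡⟨ countSubsets-interval-sized (∣⁅x⁆∪⁅y⁆∣≡2 a≢b) (⁅x⁆∪⁅y⁆⊆ (x∉p⇒x∈∁p a∉F) (x∉p⇒x∈∁p b∉F)) 1 ⟩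
  (∣ ∁ F ∣ ∸ 2) choose 1
    ≡⟨ nC1≡n _ ⟩
  ∣ ∁ F ∣ ∸ 2
    ≡⟨ cong (_∸ 2) (trans (∣∁p∣≡n∸∣p∣ F) (cong (n ∸_) ∣F∣≡f)) ⟩
  n ∸ f ∸ 2
    ≡⟨ ∸-+-assoc n f 2 ⟩
  n ∸ (f + 2) ∎
  where open ≡-Reasoning

countSubsets-⊇triple : {a b c : Fin n} → a ≢ b → a ≢ c → b ≢ c →
  countSubsets (interval? (⁅ a ⁆ ∪ ⁅ b ⁆ ∪ ⁅ c ⁆) ⊤ 3) ≡ 1
countSubsets-⊇triple {a = a} {b} {c} a≢b a≢c b≢c =
  countSubsets-interval-sized {T = ⁅ a ⁆ ∪ ⁅ b ⁆ ∪ ⁅ c ⁆} (∣⁅x⁆∪⁅y⁆∪⁅z⁆∣≡3 a≢b a≢c b≢c) ⊆⊤ 0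

-- For n ≥ 4 these are 2n − 3 and 4n − 12.
lowCount highCount : ℕ → ℕ
lowCount  n = n ∸ 2 + 1 + (n ∸ 3) + 1
highCount n = n ∸ 2 + (n ∸ 3) + (n ∸ 3) + (n ∸ 4)

lowCount-mono : ∀ {m n} → m ≤ n → lowCount m ≤ lowCount n
lowCount-mono m≤n = +-monoˡ-≤ 1 (+-mono-≤ (+-monoˡ-≤ 1 (∸-monoˡ-≤ 2 m≤n)) (∸-monoˡ-≤ 3 m≤n))

module _ (G : Graph n) where

  edge? : ∀ i j → Dec (Edge G i j)
  edge? i j = adj G i j Bool.≟ true

  edge-sym : ∀ {i j} → Edge G i j → Edge G j i
  edge-sym {i} {j} e = trans (adj-sym G j i) e

  edge⇒≢ : ∀ {i j} → Edge G i j → i ≢ j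
  edge⇒≢ {i} e refl = case trans (sym e) (irrefl G i) of λ ()

  IsVertexCover-⊆ : ∀ {S S′} → S ⊆ S′ → IsVertexCover G S → IsVertexCover G S′
  IsVertexCover-⊆ S⊆S′ cover i j e = Sum.map S⊆S′ S⊆S′ (cover i j e)

  cover-neighbour : ∀ {S i j} → IsVertexCover G S → i ∉ S → Edge G i j → j ∈ S
  cover-neighbour cover i∉S e = [ ⊥-elim ∘ i∉S , id ]′ (cover _ _ e)

  covered? : ∀ S i j → Dec (Edge G i j → i ∈ S ⊎ j ∈ S)
  covered? S i j = edge? i j →-dec ((i ∈? S) ⊎-dec (j ∈? S))

  uncovered-edge : ∀ {S} → ¬ IsVertexCover G S → ∃₂ λ i j → Edge G i j × i ∉ S × j ∉ S
  uncovered-edge {S} ¬cover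
    with i , ¬covers-i ← ¬∀⟶∃¬ n _ (λ i → all? (covered? S i)) ¬cover
    with j , ¬covers-ij ← ¬∀⟶∃¬ n _ (covered? S i) ¬covers-i
    = i , j , decidable-stable (edge? i j) (λ ¬e → ¬covers-ij (⊥-elim ∘ ¬e))
            , ¬covers-ij ∘ const ∘ inj₁ , ¬covers-ij ∘ const ∘ inj₂

  Covers : ℕ → Pred (Subset n) 0ℓ
  Covers k S = ∣ S ∣ ≡ k × IsVertexCover G S

  covers? : (k : ℕ) → Decidable (Covers k)
  covers? k S = (∣ S ∣ ≟ k) ×-dec isVertexCover? G S

  opaque
    unfolding countSubsets

    numVertexCovers≡countSubsets : ∀ k → numVertexCovers G k ≡ countSubsets (covers? k)
    numVertexCovers≡countSubsets k = refl

  -- An edge missed by T has an endpoint in every cover containing T; branch on which one.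
  covers-⊇-≤2^ : ∀ {k} → (∀ T → ∣ T ∣ < k → ¬ IsVertexCover G T) →
    ∀ d T → ∣ T ∣ + d ≡ k → countSubsets (covers? k ∩? (T ⊆?_)) ≤ 2 ^ d
  covers-⊇-≤2^ small-¬cover zero T refl = begin
    countSubsets (covers? (∣ T ∣ + 0) ∩? (T ⊆?_))
      ≤⟨ countSubsets-mono _ (interval? T ⊤ (∣ T ∣ + 0)) (λ ((∣S∣≡k , _) , T⊆S) → T⊆S , ⊆⊤ , ∣S∣≡k) ⟩
    countSubsets (interval? T ⊤ (∣ T ∣ + 0))
      ≡⟨ countSubsets-interval T ⊤ 0 ⊆⊤ ⟩
    1 ∎
    where open ≤-Reasoning
  covers-⊇-≤2^ small-¬cover (suc d) T refl
    with x , y , xy , x∉T , y∉T ← uncovered-edge (small-¬cover T (m<m+n ∣ T ∣ z<s))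
    = begin
    countSubsets (covers? k ∩? (T ⊆?_))
      ≡⟨ countSubsets-split _ (x ∈?_) ⟩
    countSubsets ((covers? k ∩? (T ⊆?_)) ∩? (x ∈?_)) + countSubsets ((covers? k ∩? (T ⊆?_)) ∩? ∁? (x ∈?_))
      ≤⟨ +-mono-≤ (countSubsets-mono _ _ λ ((cover , T⊆S) , x∈S) → cover , ∪-least (⁅x⁆⊆ x∈S) T⊆S)
                  (countSubsets-mono _ _ λ ((cover , T⊆S) , x∉S) →
                     cover , ∪-least (⁅x⁆⊆ (cover-neighbour (proj₂ cover) x∉S xy)) T⊆S) ⟩
    countSubsets (covers? k ∩? ((⁅ x ⁆ ∪ T) ⊆?_)) + countSubsets (covers? k ∩? ((⁅ y ⁆ ∪ T) ⊆?_))
      ≤⟨ +-mono-≤ (covers-⊇-≤2^ small-¬cover d (⁅ x ⁆ ∪ T) (size x∉T))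
                  (covers-⊇-≤2^ small-¬cover d (⁅ y ⁆ ∪ T) (size y∉T)) ⟩
    2 ^ d + 2 ^ d
      ≡⟨ cong (2 ^ d +_) (sym (+-identityʳ _)) ⟩
    2 ^ suc d ∎
    where
    open ≤-Reasoning
    k : ℕ
    k = ∣ T ∣ + suc d
    size : ∀ {z} → z ∉ T → ∣ ⁅ z ⁆ ∪ T ∣ + d ≡ k
    size z∉T = trans (cong (_+ d) (∣⁅x⁆∪p∣≡1+∣p∣ z∉T)) (sym (+-suc ∣ T ∣ d))

  numVertexCovers≤2^ : ∀ {k} → (∀ T → ∣ T ∣ < k → ¬ IsVertexCover G T) → numVertexCovers G k ≤ 2 ^ k
  numVertexCovers≤2^ {k} small-¬cover = begin
    numVertexCovers G k
      ≡⟨ numVertexCovers≡countSubsets k ⟩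
    countSubsets (covers? k)
      ≡⟨ countSubsets-cong (covers? k) (covers? k ∩? (⊥ ⊆?_)) ((_, ⊥⊆) , proj₁) ⟩
    countSubsets (covers? k ∩? (⊥ ⊆?_))
      ≤⟨ covers-⊇-≤2^ small-¬cover k ⊥ (cong (_+ k) (∣⊥∣≡0 n)) ⟩
    2 ^ k ∎
    where open ≤-Reasoning

  #covers₃ : {Q : Pred (Subset n) 0ℓ} → Decidable Q → ℕ
  #covers₃ Q? = countSubsets (covers? 3 ∩? Q?)

  numVertexCovers₃-quadrants : (u v : Fin n) → numVertexCovers G 3 ≡
    #covers₃ ((u ∈?_) ∩? (v ∈?_)) + #covers₃ ((u ∈?_) ∩? ∁? (v ∈?_)) +
    #covers₃ ((v ∈?_) ∩? ∁? (u ∈?_)) + #covers₃ (∁? (u ∈?_) ∩? ∁? (v ∈?_))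
  numVertexCovers₃-quadrants u v = begin
    numVertexCovers G 3
      ≡⟨ numVertexCovers≡countSubsets 3 ⟩
    countSubsets C?
      ≡⟨ countSubsets-split C? U? ⟩
    countSubsets (C? ∩? U?) + countSubsets (C? ∩? ∁? U?)
      ≡⟨ cong₂ _+_ (countSubsets-split (C? ∩? U?) V?) (countSubsets-split (C? ∩? ∁? U?) V?) ⟩
    (countSubsets ((C? ∩? U?) ∩? V?) + countSubsets ((C? ∩? U?) ∩? ∁? V?)) +
    (countSubsets ((C? ∩? ∁? U?) ∩? V?) + countSubsets ((C? ∩? ∁? U?) ∩? ∁? V?))
      ≡⟨ cong₂ _+_ (cong₂ _+_ (countSubsets-cong _ _ assoc) (countSubsets-cong _ _ assoc))
                   (cong₂ _+_ (countSubsets-cong _ _ assoc-swap) (countSubsets-cong _ _ assoc)) ⟩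
    (#covers₃ (U? ∩? V?) + #covers₃ (U? ∩? ∁? V?)) + (#covers₃ (V? ∩? ∁? U?) + #covers₃ (∁? U? ∩? ∁? V?))
      ≡⟨ sym (+-assoc (#covers₃ (U? ∩? V?) + #covers₃ (U? ∩? ∁? V?)) _ _) ⟩
    #covers₃ (U? ∩? V?) + #covers₃ (U? ∩? ∁? V?) + #covers₃ (V? ∩? ∁? U?) + #covers₃ (∁? U? ∩? ∁? V?) ∎
    where
    open ≡-Reasoning
    C? : Decidable (Covers 3)
    C? = covers? 3
    U? : Decidable (u ∈_)
    U? = u ∈?_
    V? : Decidable (v ∈_)
    V? = v ∈?_
    assoc : ∀ {P Q R : Pred (Subset n) 0ℓ} → (P ∩ Q) ∩ R ≐ P ∩ (Q ∩ R)
    assoc = (λ ((p , q) , r) → p , q , r) , (λ (p , q , r) → (p , q) , r)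
    assoc-swap : ∀ {P Q R : Pred (Subset n) 0ℓ} → (P ∩ Q) ∩ R ≐ P ∩ (R ∩ Q)
    assoc-swap = (λ ((p , q) , r) → p , r , q) , (λ (p , r , q) → (p , q) , r)

  NeighbourBesides : Fin n → Fin n → Fin n → Set
  NeighbourBesides x y a = Edge G x a × a ≢ y

  TwoNeighboursBesides : Fin n → Fin n → Set
  TwoNeighboursBesides x y = ∃₂ λ a₁ a₂ → a₁ ≢ a₂ × NeighbourBesides x y a₁ × NeighbourBesides x y a₂

  #covers₃-∋∋-≤ : {u v : Fin n} → u ≢ v → #covers₃ ((u ∈?_) ∩? (v ∈?_)) ≤ n ∸ 2
  #covers₃-∋∋-≤ {u} {v} u≢v = begin
    #covers₃ ((u ∈?_) ∩? (v ∈?_))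
      ≤⟨ countSubsets-mono _ (interval? (⁅ u ⁆ ∪ ⁅ v ⁆) (∁ ⊥) 3)
           (λ ((∣S∣≡3 , _) , u∈S , v∈S) → ⁅x⁆∪⁅y⁆⊆ u∈S v∈S , ⊆∁ (λ x∈⊥ _ → ∉⊥ x∈⊥) , ∣S∣≡3) ⟩
    countSubsets (interval? (⁅ u ⁆ ∪ ⁅ v ⁆) (∁ ⊥) 3)
      ≡⟨ countSubsets-⊇pair-avoiding (∣⊥∣≡0 n) u≢v ∉⊥ ∉⊥ ⟩
    n ∸ 2 ∎
    where open ≤-Reasoning

  #covers₃-∋∌-≤1 : {u v : Fin n} → TwoNeighboursBesides v u → #covers₃ ((u ∈?_) ∩? ∁? (v ∈?_)) ≤ 1
  #covers₃-∋∌-≤1 {u} {v} (b₁ , b₂ , b₁≢b₂ , (vb₁ , b₁≢u) , (vb₂ , b₂≢u)) = begin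
    #covers₃ ((u ∈?_) ∩? ∁? (v ∈?_))
      ≤⟨ countSubsets-mono _ (interval? (⁅ u ⁆ ∪ ⁅ b₁ ⁆ ∪ ⁅ b₂ ⁆) ⊤ 3)
           (λ ((∣S∣≡3 , cover) , u∈S , v∉S) →
             ⁅x⁆∪⁅y⁆∪⁅z⁆⊆ u∈S (cover-neighbour cover v∉S vb₁) (cover-neighbour cover v∉S vb₂) ,
             ⊆⊤ , ∣S∣≡3) ⟩
    countSubsets (interval? (⁅ u ⁆ ∪ ⁅ b₁ ⁆ ∪ ⁅ b₂ ⁆) ⊤ 3)
      ≡⟨ countSubsets-⊇triple (≢-sym b₁≢u) (≢-sym b₂≢u) b₁≢b₂ ⟩
    1 ∎
    where open ≤-Reasoning

  #covers₃-∋∌-≤ : {u v b : Fin n} → u ≢ v → NeighbourBesides v u b →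
    #covers₃ ((u ∈?_) ∩? ∁? (v ∈?_)) ≤ n ∸ 3
  #covers₃-∋∌-≤ {u} {v} {b} u≢v (vb , b≢u) = begin
    #covers₃ ((u ∈?_) ∩? ∁? (v ∈?_))
      ≤⟨ countSubsets-mono _ (interval? (⁅ u ⁆ ∪ ⁅ b ⁆) (∁ ⁅ v ⁆) 3)
           (λ ((∣S∣≡3 , cover) , u∈S , v∉S) →
             ⁅x⁆∪⁅y⁆⊆ u∈S (cover-neighbour cover v∉S vb) , ⊆∁⁅x⁆ v∉S , ∣S∣≡3) ⟩
    countSubsets (interval? (⁅ u ⁆ ∪ ⁅ b ⁆) (∁ ⁅ v ⁆) 3)
      ≡⟨ countSubsets-⊇pair-avoiding (∣⁅x⁆∣≡1 v) (≢-sym b≢u)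
           (x≢y⇒x∉⁅y⁆ u≢v) (x≢y⇒x∉⁅y⁆ (≢-sym (edge⇒≢ vb))) ⟩
    n ∸ 3 ∎
    where open ≤-Reasoning

  #covers₃-∌∌-≡0 : {u v : Fin n} → Edge G u v → #covers₃ (∁? (u ∈?_) ∩? ∁? (v ∈?_)) ≡ 0
  #covers₃-∌∌-≡0 uv =
    countSubsets-empty _ λ S ((_ , cover) , u∉S , v∉S) → v∉S (cover-neighbour cover u∉S uv)

  #covers₃-∌∌-≤ : {u v : Fin n} → u ≢ v → TwoNeighboursBesides u v →
    #covers₃ (∁? (u ∈?_) ∩? ∁? (v ∈?_)) ≤ n ∸ 4
  #covers₃-∌∌-≤ {u} {v} u≢v (a₁ , a₂ , a₁≢a₂ , (ua₁ , a₁≢v) , (ua₂ , a₂≢v)) = begin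
    #covers₃ (∁? (u ∈?_) ∩? ∁? (v ∈?_))
      ≤⟨ countSubsets-mono _ (interval? (⁅ a₁ ⁆ ∪ ⁅ a₂ ⁆) (∁ (⁅ u ⁆ ∪ ⁅ v ⁆)) 3)
           (λ ((∣S∣≡3 , cover) , u∉S , v∉S) →
             ⁅x⁆∪⁅y⁆⊆ (cover-neighbour cover u∉S ua₁) (cover-neighbour cover u∉S ua₂) ,
             ⊆∁⁅x⁆∪⁅y⁆ u∉S v∉S , ∣S∣≡3) ⟩
    countSubsets (interval? (⁅ a₁ ⁆ ∪ ⁅ a₂ ⁆) (∁ (⁅ u ⁆ ∪ ⁅ v ⁆)) 3)
      ≡⟨ countSubsets-⊇pair-avoiding (∣⁅x⁆∪⁅y⁆∣≡2 u≢v) a₁≢a₂ (∉⁅u⁆∪⁅v⁆ ua₁ a₁≢v) (∉⁅u⁆∪⁅v⁆ ua₂ a₂≢v) ⟩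
    n ∸ 4 ∎
    where
    open ≤-Reasoning
    ∉⁅u⁆∪⁅v⁆ : ∀ {a} → Edge G u a → a ≢ v → a ∉ ⁅ u ⁆ ∪ ⁅ v ⁆
    ∉⁅u⁆∪⁅v⁆ ua a≢v = [ ≢-sym (edge⇒≢ ua) , a≢v ]′ ∘ x∈⁅y⁆∪⁅z⁆⇒

  #covers₃-∌∌-≤1 : {u v a b c : Fin n} → a ≢ b → a ≢ c → b ≢ c →
    Edge G u a ⊎ Edge G v a → Edge G u b ⊎ Edge G v b → Edge G u c ⊎ Edge G v c →
    #covers₃ (∁? (u ∈?_) ∩? ∁? (v ∈?_)) ≤ 1
  #covers₃-∌∌-≤1 {u} {v} {a} {b} {c} a≢b a≢c b≢c a∼ b∼ c∼ = begin
    #covers₃ (∁? (u ∈?_) ∩? ∁? (v ∈?_))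
      ≤⟨ countSubsets-mono _ (interval? (⁅ a ⁆ ∪ ⁅ b ⁆ ∪ ⁅ c ⁆) ⊤ 3)
           (λ ((∣S∣≡3 , cover) , u∉S , v∉S) →
             ⁅x⁆∪⁅y⁆∪⁅z⁆⊆ (forced cover u∉S v∉S a∼) (forced cover u∉S v∉S b∼) (forced cover u∉S v∉S c∼) ,
             ⊆⊤ , ∣S∣≡3) ⟩
    countSubsets (interval? (⁅ a ⁆ ∪ ⁅ b ⁆ ∪ ⁅ c ⁆) ⊤ 3)
      ≡⟨ countSubsets-⊇triple a≢b a≢c b≢c ⟩
    1 ∎
    where
    open ≤-Reasoning
    forced : ∀ {S x} → IsVertexCover G S → u ∉ S → v ∉ S → Edge G u x ⊎ Edge G v x → x ∈ S
    forced cover u∉S v∉S = [ cover-neighbour cover u∉S , cover-neighbour cover v∉S ]′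

  highCount≤numVertexCovers₃ : {u v a b : Fin n} → u ≢ v → u ≢ a → u ≢ b → v ≢ a → v ≢ b → a ≢ b →
    (∀ S → u ∈ S ⊎ a ∈ S → v ∈ S ⊎ b ∈ S → IsVertexCover G S) → highCount n ≤ numVertexCovers G 3
  highCount≤numVertexCovers₃ {u} {v} {a} {b} u≢v u≢a u≢b v≢a v≢b a≢b hitting⇒cover = begin
    n ∸ 2 + (n ∸ 3) + (n ∸ 3) + (n ∸ 4)
      ≤⟨ +-mono-≤ (+-mono-≤ (+-mono-≤ Q₁₁ Q₁₀) Q₀₁) Q₀₀ ⟩
    #covers₃ ((u ∈?_) ∩? (v ∈?_)) + #covers₃ ((u ∈?_) ∩? ∁? (v ∈?_)) +
    #covers₃ ((v ∈?_) ∩? ∁? (u ∈?_)) + #covers₃ (∁? (u ∈?_) ∩? ∁? (v ∈?_))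
      ≡⟨ numVertexCovers₃-quadrants u v ⟨
    numVertexCovers G 3 ∎
    where
    open ≤-Reasoning
    Q₁₁ : n ∸ 2 ≤ #covers₃ ((u ∈?_) ∩? (v ∈?_))
    Q₁₁ = begin
      n ∸ 2 ≡⟨ countSubsets-⊇pair-avoiding (∣⊥∣≡0 n) u≢v ∉⊥ ∉⊥ ⟨
      countSubsets (interval? (⁅ u ⁆ ∪ ⁅ v ⁆) (∁ ⊥) 3)
        ≤⟨ countSubsets-mono _ _ (λ (T⊆S , _ , ∣S∣≡3) →
             let u∈S = T⊆S x∈⁅x⁆∪⁅y⁆; v∈S = T⊆S y∈⁅x⁆∪⁅y⁆
             in (∣S∣≡3 , hitting⇒cover _ (inj₁ u∈S) (inj₁ v∈S)) , u∈S , v∈S) ⟩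
      #covers₃ ((u ∈?_) ∩? (v ∈?_)) ∎
    Q₁₀ : n ∸ 3 ≤ #covers₃ ((u ∈?_) ∩? ∁? (v ∈?_))
    Q₁₀ = begin
      n ∸ 3 ≡⟨ countSubsets-⊇pair-avoiding (∣⁅x⁆∣≡1 v) u≢b (x≢y⇒x∉⁅y⁆ u≢v) (x≢y⇒x∉⁅y⁆ (≢-sym v≢b)) ⟨
      countSubsets (interval? (⁅ u ⁆ ∪ ⁅ b ⁆) (∁ ⁅ v ⁆) 3)
        ≤⟨ countSubsets-mono _ _ (λ (T⊆S , S⊆U , ∣S∣≡3) →
             let u∈S = T⊆S x∈⁅x⁆∪⁅y⁆; b∈S = T⊆S y∈⁅x⁆∪⁅y⁆
             in (∣S∣≡3 , hitting⇒cover _ (inj₁ u∈S) (inj₂ b∈S)) , u∈S , ⊆∁⇒∉ S⊆U (x∈⁅x⁆ v)) ⟩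
      #covers₃ ((u ∈?_) ∩? ∁? (v ∈?_)) ∎
    Q₀₁ : n ∸ 3 ≤ #covers₃ ((v ∈?_) ∩? ∁? (u ∈?_))
    Q₀₁ = begin
      n ∸ 3 ≡⟨ countSubsets-⊇pair-avoiding (∣⁅x⁆∣≡1 u) v≢a (x≢y⇒x∉⁅y⁆ (≢-sym u≢v)) (x≢y⇒x∉⁅y⁆ (≢-sym u≢a)) ⟨
      countSubsets (interval? (⁅ v ⁆ ∪ ⁅ a ⁆) (∁ ⁅ u ⁆) 3)
        ≤⟨ countSubsets-mono _ _ (λ (T⊆S , S⊆U , ∣S∣≡3) →
             let v∈S = T⊆S x∈⁅x⁆∪⁅y⁆; a∈S = T⊆S y∈⁅x⁆∪⁅y⁆
             in (∣S∣≡3 , hitting⇒cover _ (inj₂ a∈S) (inj₁ v∈S)) , v∈S , ⊆∁⇒∉ S⊆U (x∈⁅x⁆ u)) ⟩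
      #covers₃ ((v ∈?_) ∩? ∁? (u ∈?_)) ∎
    Q₀₀ : n ∸ 4 ≤ #covers₃ (∁? (u ∈?_) ∩? ∁? (v ∈?_))
    Q₀₀ = begin
      n ∸ 4 ≡⟨ countSubsets-⊇pair-avoiding (∣⁅x⁆∪⁅y⁆∣≡2 u≢v) a≢b
                 ([ ≢-sym u≢a , ≢-sym v≢a ]′ ∘ x∈⁅y⁆∪⁅z⁆⇒) ([ ≢-sym u≢b , ≢-sym v≢b ]′ ∘ x∈⁅y⁆∪⁅z⁆⇒) ⟨
      countSubsets (interval? (⁅ a ⁆ ∪ ⁅ b ⁆) (∁ (⁅ u ⁆ ∪ ⁅ v ⁆)) 3)
        ≤⟨ countSubsets-mono _ _ (λ (T⊆S , S⊆U , ∣S∣≡3) →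
             let a∈S = T⊆S x∈⁅x⁆∪⁅y⁆; b∈S = T⊆S y∈⁅x⁆∪⁅y⁆
             in (∣S∣≡3 , hitting⇒cover _ (inj₂ a∈S) (inj₂ b∈S)) ,
                ⊆∁⇒∉ S⊆U x∈⁅x⁆∪⁅y⁆ , ⊆∁⇒∉ S⊆U y∈⁅x⁆∪⁅y⁆) ⟩
      #covers₃ (∁? (u ∈?_) ∩? ∁? (v ∈?_)) ∎

  neighbours⊆? : ∀ x (X : Subset n) → (∃ λ w → Edge G x w × w ∉ X) ⊎ (∀ {w} → Edge G x w → w ∈ X)
  neighbours⊆? x X with any? (λ w → edge? x w ×-dec ¬? (w ∈? X))
  ... | yes outside-X = inj₁ outside-X
  ... | no  ∄        = inj₂ λ {w} xw → decidable-stable (w ∈? X) (λ w∉X → ∄ (w , xw , w∉X))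

  two-or-only-neighbour : ∀ {x y a} → NeighbourBesides x y a →
    TwoNeighboursBesides x y ⊎ (∀ {w} → Edge G x w → w ≡ y ⊎ w ≡ a)
  two-or-only-neighbour {x} {y} {a} (xa , a≢y) with neighbours⊆? x (⁅ y ⁆ ∪ ⁅ a ⁆)
  ... | inj₁ (w , xw , w∉) =
    inj₁ (a , w , (λ { refl → w∉ y∈⁅x⁆∪⁅y⁆ }) , (xa , a≢y) , (xw , λ { refl → w∉ x∈⁅x⁆∪⁅y⁆ }))
  ... | inj₂ N⊆           = inj₂ (x∈⁅y⁆∪⁅z⁆⇒ ∘ N⊆)

Joins : Fin n → Fin n → Fin n → Fin n → Set
Joins i j x y = (i ≡ x × j ≡ y) ⊎ (i ≡ y × j ≡ x)

Joins₃-sym : {i j a b c d e f : Fin n} →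
  Joins i j a b ⊎ Joins i j c d ⊎ Joins i j e f → Joins j i a b ⊎ Joins j i c d ⊎ Joins j i e f
Joins₃-sym = Sum.map sym₁ (Sum.map sym₁ sym₁)
  where sym₁ : ∀ {i j x y} → Joins i j x y → Joins j i x y
        sym₁ = [ inj₂ ∘ swap , inj₁ ∘ swap ]′

-- Graphs with a vertex cover of size two

module PairCover (G : Graph n) {u v : Fin n} (u≢v : u ≢ v)
                 (uv-cover : IsVertexCover G (⁅ u ⁆ ∪ ⁅ v ⁆)) where

  edges-at-u-or-v : {R : Fin n → Fin n → Set} → (∀ {i j} → R i j → R j i) →
    (∀ {j} → Edge G u j → R u j) → (∀ {j} → Edge G v j → R v j) → ∀ i j → Edge G i j → R i j
  edges-at-u-or-v {R} R-sym at-u at-v i j ij =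
    [ (λ i∈ → at i∈ ij) , (λ j∈ → R-sym (at j∈ (edge-sym G ij))) ]′ (uv-cover i j ij)
    where at : ∀ {x y} → x ∈ ⁅ u ⁆ ∪ ⁅ v ⁆ → Edge G x y → R x y
          at x∈ = [ (λ { refl → at-u }) , (λ { refl → at-v }) ]′ (x∈⁅y⁆∪⁅z⁆⇒ x∈)

  neighbour-of-v : (∀ x → ¬ IsVertexCover G ⁅ x ⁆) → ∃ (NeighbourBesides G v u)
  neighbour-of-v no-singleton-cover
    with i , j , ij , i∉⁅u⁆ , j∉⁅u⁆ ← uncovered-edge G (no-singleton-cover u)
    with uv-cover i j ij
  ... | inj₁ i∈ = [ (λ { refl → ⊥-elim (i∉⁅u⁆ (x∈⁅x⁆ u)) })
                  , (λ { refl → j , ij , x∉⁅y⁆⇒x≢y j∉⁅u⁆ }) ]′ (x∈⁅y⁆∪⁅z⁆⇒ i∈)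
  ... | inj₂ j∈ = [ (λ { refl → ⊥-elim (j∉⁅u⁆ (x∈⁅x⁆ u)) })
                  , (λ { refl → i , edge-sym G ij , x∉⁅y⁆⇒x≢y i∉⁅u⁆ }) ]′ (x∈⁅y⁆∪⁅z⁆⇒ j∈)

  case-two-two : TwoNeighboursBesides G u v → TwoNeighboursBesides G v u → numVertexCovers G 3 ≤ lowCount n
  case-two-two two-u two-v = begin
    numVertexCovers G 3
      ≡⟨ numVertexCovers₃-quadrants G u v ⟩
    #covers₃ G ((u ∈?_) ∩? (v ∈?_)) + #covers₃ G ((u ∈?_) ∩? ∁? (v ∈?_)) +
    #covers₃ G ((v ∈?_) ∩? ∁? (u ∈?_)) + #covers₃ G (∁? (u ∈?_) ∩? ∁? (v ∈?_))
      ≤⟨ +-mono-≤ (+-mono-≤ (+-mono-≤ (#covers₃-∋∋-≤ G u≢v) (#covers₃-∋∌-≤1 G two-v))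
                            (#covers₃-∋∌-≤1 G two-u))
                  (#covers₃-∌∌-≤ G u≢v two-u) ⟩
    n ∸ 2 + 1 + 1 + (n ∸ 4)
      ≡⟨ +-assoc (n ∸ 2 + 1) 1 (n ∸ 4) ⟩
    n ∸ 2 + 1 + (1 + (n ∸ 4))
      ≤⟨ +-monoʳ-≤ (n ∸ 2 + 1) (≤-trans (s≤s (∸-monoʳ-≤ n (n≤1+n 3))) (≤-reflexive (+-comm 1 (n ∸ 3)))) ⟩
    n ∸ 2 + 1 + ((n ∸ 3) + 1)
      ≡⟨ +-assoc (n ∸ 2 + 1) (n ∸ 3) 1 ⟨
    lowCount n ∎
    where open ≤-Reasoning

  #covers₃-∌∌-≤1⊎P4 : ∀ {a b} → NeighbourBesides G u v a → (∀ {w} → Edge G u w → w ≡ v ⊎ w ≡ a) →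
    ¬ Edge G u v → NeighbourBesides G v u b → a ≢ b → Edge G v a →
    #covers₃ G (∁? (u ∈?_) ∩? ∁? (v ∈?_)) ≤ 1 ⊎ IsP4PlusIsolated G
  #covers₃-∌∌-≤1⊎P4 {a} {b} (ua , a≢v) only-a ¬uv (vb , b≢u) a≢b va
    with neighbours⊆? G v (⁅ u ⁆ ∪ ⁅ a ⁆ ∪ ⁅ b ⁆)
  ... | inj₁ (w , vw , w∉) = inj₁ (#covers₃-∌∌-≤1 G a≢b (λ { refl → w∉ (q⊆p∪q _ _ x∈⁅x⁆∪⁅y⁆) })
                                    (λ { refl → w∉ (q⊆p∪q _ _ y∈⁅x⁆∪⁅y⁆) }) (inj₁ ua) (inj₂ vb) (inj₂ vw))
  ... | inj₂ N⊆ = inj₂ (u , a , v , b , edge⇒≢ G ua , u≢v , ≢-sym b≢u , a≢v , a≢b , edge⇒≢ G vb ,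
                        edges-at-u-or-v Joins₃-sym at-u at-v , ua , edge-sym G va , vb)
    where
    at-u : ∀ {j} → Edge G u j → Joins u j u a ⊎ Joins u j a v ⊎ Joins u j v b
    at-u uj with only-a uj
    ... | inj₁ refl = ⊥-elim (¬uv uj)
    ... | inj₂ refl = inj₁ (inj₁ (refl , refl))
    at-v : ∀ {j} → Edge G v j → Joins v j u a ⊎ Joins v j a v ⊎ Joins v j v b
    at-v vj with x∈⁅y⁆∪⁅z⁆∪⁅w⁆⇒ (N⊆ vj)
    ... | inj₁ refl        = ⊥-elim (¬uv (edge-sym G vj))
    ... | inj₂ (inj₁ refl) = inj₂ (inj₁ (inj₂ (refl , refl)))
    ... | inj₂ (inj₂ refl) = inj₂ (inj₂ (inj₁ (refl , refl)))

  case-only-two-∌∌ : ∀ {a} → NeighbourBesides G u v a → (∀ {w} → Edge G u w → w ≡ v ⊎ w ≡ a) →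
    TwoNeighboursBesides G v u → #covers₃ G (∁? (u ∈?_) ∩? ∁? (v ∈?_)) ≤ 1 ⊎ IsP4PlusIsolated G
  case-only-two-∌∌ {a} ua only-a (b₁ , b₂ , b₁≢b₂ , (vb₁ , b₁≢u) , (vb₂ , b₂≢u)) with edge? G u v
  ... | yes uv = inj₁ (≤-trans (≤-reflexive (#covers₃-∌∌-≡0 G uv)) z≤n)
  ... | no ¬uv with a Fin.≟ b₁ | a Fin.≟ b₂
  ...   | no a≢b₁ | no a≢b₂ =
    inj₁ (#covers₃-∌∌-≤1 G a≢b₁ a≢b₂ b₁≢b₂ (inj₁ (proj₁ ua)) (inj₂ vb₁) (inj₂ vb₂))
  ...   | yes refl | _      = #covers₃-∌∌-≤1⊎P4 ua only-a ¬uv (vb₂ , b₂≢u) b₁≢b₂ vb₁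
  ...   | _ | yes refl      = #covers₃-∌∌-≤1⊎P4 ua only-a ¬uv (vb₁ , b₁≢u) (≢-sym b₁≢b₂) vb₂

  case-only-two : ∀ {a} → NeighbourBesides G u v a → (∀ {w} → Edge G u w → w ≡ v ⊎ w ≡ a) →
    TwoNeighboursBesides G v u → numVertexCovers G 3 ≤ lowCount n ⊎ IsP4PlusIsolated G
  case-only-two ua only-a two-v = Sum.map₁ bound (case-only-two-∌∌ ua only-a two-v)
    where
    bound : #covers₃ G (∁? (u ∈?_) ∩? ∁? (v ∈?_)) ≤ 1 → numVertexCovers G 3 ≤ lowCount n
    bound Q₀₀≤1 = begin
      numVertexCovers G 3
        ≡⟨ numVertexCovers₃-quadrants G u v ⟩
      #covers₃ G ((u ∈?_) ∩? (v ∈?_)) + #covers₃ G ((u ∈?_) ∩? ∁? (v ∈?_)) +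
      #covers₃ G ((v ∈?_) ∩? ∁? (u ∈?_)) + #covers₃ G (∁? (u ∈?_) ∩? ∁? (v ∈?_))
        ≤⟨ +-mono-≤ (+-mono-≤ (+-mono-≤ (#covers₃-∋∋-≤ G u≢v) (#covers₃-∋∌-≤1 G two-v))
                              (#covers₃-∋∌-≤ G (≢-sym u≢v) ua)) Q₀₀≤1 ⟩
      lowCount n ∎
      where open ≤-Reasoning

  case-only-only : ∀ {a b} → NeighbourBesides G u v a → (∀ {w} → Edge G u w → w ≡ v ⊎ w ≡ a) →
    NeighbourBesides G v u b → (∀ {w} → Edge G v w → w ≡ u ⊎ w ≡ b) → (∀ x → ¬ IsVertexCover G ⁅ x ⁆) →
    highCount n ≤ numVertexCovers G 3 ⊎ IsK3PlusIsolated G ⊎ IsP4PlusIsolated G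
  case-only-only {a} {b} (ua , a≢v) only-a (vb , b≢u) only-b no-singleton-cover with edge? G u v | a Fin.≟ b
  ... | yes uv | yes refl = inj₂ (inj₁ (u , v , a , u≢v , edge⇒≢ G ua , edge⇒≢ G vb ,
                                       edges-at-u-or-v Joins₃-sym at-u at-v , uv , vb , ua))
    where
    at-u : ∀ {j} → Edge G u j → Joins u j u v ⊎ Joins u j v a ⊎ Joins u j u a
    at-u uj with only-a uj
    ... | inj₁ refl = inj₁ (inj₁ (refl , refl))
    ... | inj₂ refl = inj₂ (inj₂ (inj₁ (refl , refl)))
    at-v : ∀ {j} → Edge G v j → Joins v j u v ⊎ Joins v j v a ⊎ Joins v j u a
    at-v vj with only-b vj
    ... | inj₁ refl = inj₁ (inj₂ (refl , refl))
    ... | inj₂ refl = inj₂ (inj₁ (inj₁ (refl , refl)))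
  ... | yes uv | no a≢b = inj₂ (inj₂ (a , u , v , b , ≢-sym (edge⇒≢ G ua) , a≢v , a≢b , u≢v , ≢-sym b≢u ,
                                     edge⇒≢ G vb , edges-at-u-or-v Joins₃-sym at-u at-v ,
                                     edge-sym G ua , uv , vb))
    where
    at-u : ∀ {j} → Edge G u j → Joins u j a u ⊎ Joins u j u v ⊎ Joins u j v b
    at-u uj with only-a uj
    ... | inj₁ refl = inj₂ (inj₁ (inj₁ (refl , refl)))
    ... | inj₂ refl = inj₁ (inj₂ (refl , refl))
    at-v : ∀ {j} → Edge G v j → Joins v j a u ⊎ Joins v j u v ⊎ Joins v j v b
    at-v vj with only-b vj
    ... | inj₁ refl = inj₂ (inj₁ (inj₂ (refl , refl)))
    ... | inj₂ refl = inj₂ (inj₂ (inj₁ (refl , refl)))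
  ... | no ¬uv | yes refl = ⊥-elim (no-singleton-cover a (edges-at-u-or-v Sum.swap at-u at-v))
    where
    at-u : ∀ {j} → Edge G u j → u ∈ ⁅ a ⁆ ⊎ j ∈ ⁅ a ⁆
    at-u uj with only-a uj
    ... | inj₁ refl = ⊥-elim (¬uv uj)
    ... | inj₂ refl = inj₂ (x∈⁅x⁆ a)
    at-v : ∀ {j} → Edge G v j → v ∈ ⁅ a ⁆ ⊎ j ∈ ⁅ a ⁆
    at-v vj with only-b vj
    ... | inj₁ refl = ⊥-elim (¬uv (edge-sym G vj))
    ... | inj₂ refl = inj₂ (x∈⁅x⁆ a)
  ... | no ¬uv | no a≢b = inj₁ (highCount≤numVertexCovers₃ G u≢v (edge⇒≢ G ua) (≢-sym b≢u) (≢-sym a≢v)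
                                  (edge⇒≢ G vb) a≢b hitting⇒cover)
    where
    hitting⇒cover : ∀ S → u ∈ S ⊎ a ∈ S → v ∈ S ⊎ b ∈ S → IsVertexCover G S
    hitting⇒cover S u∨a v∨b = edges-at-u-or-v Sum.swap at-u at-v
      where
      at-u : ∀ {j} → Edge G u j → u ∈ S ⊎ j ∈ S
      at-u uj with only-a uj
      ... | inj₁ refl = ⊥-elim (¬uv uj)
      ... | inj₂ refl = u∨a
      at-v : ∀ {j} → Edge G v j → v ∈ S ⊎ j ∈ S
      at-v vj with only-b vj
      ... | inj₁ refl = ⊥-elim (¬uv (edge-sym G vj))
      ... | inj₂ refl = v∨b

Covers₃Outcome : Graph n → Set
Covers₃Outcome {n} G = (numVertexCovers G 3 ≤ lowCount n ⊎ highCount n ≤ numVertexCovers G 3) ⊎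
                       (IsK3PlusIsolated G ⊎ IsP4PlusIsolated G)

pair-cover-outcome : (G : Graph n) {u v : Fin n} → u ≢ v → IsVertexCover G (⁅ u ⁆ ∪ ⁅ v ⁆) →
  (∀ x → ¬ IsVertexCover G ⁅ x ⁆) → Covers₃Outcome G
pair-cover-outcome G {u} {v} u≢v uv-cover no-singleton-cover =
  cases (two-or-only-neighbour G (proj₂ a)) (two-or-only-neighbour G (proj₂ b))
  where
  module UV = PairCover G u≢v uv-cover
  module VU = PairCover G (≢-sym u≢v) (IsVertexCover-⊆ G (⁅x⁆∪⁅y⁆⊆ y∈⁅x⁆∪⁅y⁆ x∈⁅x⁆∪⁅y⁆) uv-cover)
  a : ∃ (NeighbourBesides G u v)
  a = VU.neighbour-of-v no-singleton-cover
  b : ∃ (NeighbourBesides G v u)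
  b = UV.neighbour-of-v no-singleton-cover
  cases : TwoNeighboursBesides G u v ⊎ (∀ {w} → Edge G u w → w ≡ v ⊎ w ≡ proj₁ a) →
          TwoNeighboursBesides G v u ⊎ (∀ {w} → Edge G v w → w ≡ u ⊎ w ≡ proj₁ b) → Covers₃Outcome G
  cases (inj₁ two-u)  (inj₁ two-v)  = inj₁ (inj₁ (UV.case-two-two two-u two-v))
  cases (inj₂ only-a) (inj₁ two-v)  = Sum.map inj₁ inj₂ (UV.case-only-two (proj₂ a) only-a two-v)
  cases (inj₁ two-u)  (inj₂ only-b) = Sum.map inj₁ inj₂ (VU.case-only-two (proj₂ b) only-b two-u)
  cases (inj₂ only-a) (inj₂ only-b) =
    Sum.map₁ inj₂ (UV.case-only-only (proj₂ a) only-a (proj₂ b) only-b no-singleton-cover)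

covers₃-outcome : (G : Graph (suc n)) → 5 ≤ n → (∀ x → ¬ IsVertexCover G ⁅ x ⁆) → Covers₃Outcome G
covers₃-outcome G 5≤n no-singleton-cover with anySubset? (λ T → (∣ T ∣ ≤? 2) ×-dec isVertexCover? G T)
... | no ∄small-cover =
  inj₁ (inj₁ (≤-trans (numVertexCovers≤2^ G small-¬cover) (≤-trans (n≤1+n 8) (lowCount-mono (s≤s 5≤n)))))
  where small-¬cover : ∀ T → ∣ T ∣ < 3 → ¬ IsVertexCover G T
        small-¬cover T (s≤s ∣T∣≤2) T-cover = ∄small-cover (T , ∣T∣≤2 , T-cover)
... | yes (T , ∣T∣≤2 , T-cover) with u , v , T⊆ ← ⊆⁅x⁆∪⁅y⁆ T ∣T∣≤2 =
  pair-cover-outcome G u≢v uv-cover no-singleton-cover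
  where
  uv-cover : IsVertexCover G (⁅ u ⁆ ∪ ⁅ v ⁆)
  uv-cover = IsVertexCover-⊆ G T⊆ T-cover
  u≢v : u ≢ v
  u≢v u≡v = no-singleton-cover u
    (subst (IsVertexCover G) (trans (cong (λ x → ⁅ u ⁆ ∪ ⁅ x ⁆) (sym u≡v)) (∪-idem ⁅ u ⁆)) uv-cover)

lowCount-excluded : ∀ {r c} → 5 ≤ r → c ≤ lowCount (suc r) → ¬ ((4 * r ∸ 16) * (r + 2) + 36 ≤ c * (r + 2))
lowCount-excluded {c = c} 5≤r c≤low lower-bound with t , refl ← m≤n⇒∃[o]m+o≡n 5≤r =
  ≤⇒≯ (*-monoˡ-≤ (5 + t + 2) c≤low) (begin-strict
    lowCount (6 + t) * (5 + t + 2)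
      <⟨ m<m+n _ z<s ⟩
    lowCount (6 + t) * (5 + t + 2) + (1 + (t * 9 + t * t * 2))
      ≡⟨ expand t ⟩
    (4 + 4 * t) * (5 + t + 2) + 36
      ≡⟨ cong (λ x → (x ∸ 16) * (5 + t + 2) + 36) (four-times t) ⟨
    (4 * (5 + t) ∸ 16) * (5 + t + 2) + 36
      ≤⟨ lower-bound ⟩
    c * (5 + t + 2) ∎)
  where
  open ≤-Reasoning
  expand : ∀ t → (4 + t + 1 + (3 + t) + 1) * (5 + t + 2) + (1 + (t * 9 + t * t * 2)) ≡
                 (4 + 4 * t) * (5 + t + 2) + 36
  expand = solve-∀
  four-times : ∀ t → 4 * (5 + t) ≡ 16 + (4 + 4 * t)
  four-times = solve-∀

highCount-excluded : ∀ {r c} → 5 ≤ r → highCount (suc r) ≤ c → ¬ (c < 4 * r ∸ 8)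
highCount-excluded {c = c} 5≤r high≤c c<4r-8 with t , refl ← m≤n⇒∃[o]m+o≡n 5≤r =
  ≤⇒≯ high≤c (begin-strict
    c               <⟨ c<4r-8 ⟩
    4 * (5 + t) ∸ 8 ≡⟨ cong (_∸ 8) (four-times t) ⟩
    highCount (6 + t) ∎)
  where
  open ≤-Reasoning
  four-times : ∀ t → 4 * (5 + t) ≡ 8 + (4 + t + (3 + t) + (3 + t) + (2 + t))
  four-times = solve-∀

lemma5p5 : (r : ℕ) → 5 ≤ r → (C : Graph (suc r)) →
    (∀ (S : Subset (suc r)) → ∣ S ∣ ≡ 1 → ¬ IsVertexCover C S) →
    (4 * r ∸ 16) * (r + 2) + 36 ≤ numVertexCovers C 3 * (r + 2) →
    numVertexCovers C 3 < 4 * r ∸ 8 →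
    IsK3PlusIsolated C ⊎ IsP4PlusIsolated C
lemma5p5 r 5≤r C no-1-cover lower upper =
  [ [ (λ few → ⊥-elim (lowCount-excluded 5≤r few lower))
    , (λ many → ⊥-elim (highCount-excluded 5≤r many upper)) ]′
  , id ]′ (covers₃-outcome C 5≤r (λ x → no-1-cover ⁅ x ⁆ (∣⁅x⁆∣≡1 x)))
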